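{- Let $f,g$ be systems with $\mathrm{Comp}(g)\subseteq\mathrm{Comp}(f)$, let $\sigma$ be an implementation of $g$ in $f$, let $\mathcal{V}$ be a valuation, and let $\alpha\in\mathcal{L}(\mathrm{Comp}(g))$. Then for all $x\in\mathrm{Beh}(f)$: $f,\mathcal{V},x\models\alpha$ if and only if $g,\mathcal{V},\sigma(x)\models\alpha$.
   Context: Fix a collection $\mathbb{C}$ of basic components; each $c\in\mathbb{C}$ has a set $\mathrm{Beh}(c)$. For nonempty $C\subseteq\mathbb{C}$, $\mathrm{Beh}(C):=\prod_{c\in C}\mathrm{Beh}(c)$. A system is a function $f:B\to\mathrm{Beh}(C)$; $\mathrm{Beh}(f):=B$, $\mathrm{Comp}(f):=C$; for $c\in C$, $f_c$ is $f$ followed by projection onto $\mathrm{Beh}(c)$, and similarly $f_D$ for $D\subseteq C$. An implementation of $g$ in $f$ (where $\mathrm{Comp}(g)\subseteq\mathrm{Comp}(f)$) is a map $\sigma:\mathrm{Beh}(f)\to\mathrm{Beh}(g)$ with $f_{\mathrm{Comp}(g)}=g\circ\sigma$. Each $c\in\mathbb{C}$ has a set $Var(c)$ of variables, these sets pairwise disjoint; a valuation $\mathcal{V}$ maps each $p\in Var(c)$ to a subset of $\mathrm{Beh}(c)$. For $C\subseteq\mathbb{C}$, $\mathcal{L}(C)$ is the set of formulas built from variables in $\bigcup_{c\in C}Var(c)$ using $\land$ and $\lnot$, interpreted at triples $(f,\mathcal{V},x)$ with $\mathrm{Comp}(f)\supseteq C$ and $x\in\mathrm{Beh}(f)$: $f,\mathcal{V},x\models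 p$ iff $f_c(x)\in\mathcal{V}(p)$ for $p\in Var(c)$; $\land$ and $\lnot$ are interpreted classically. -}

module Defs where

open import Level using (Level; _⊔_; suc)
open import Data.Product using (Σ; _×_; _,_)
open import Data.Empty using (⊥)
open import Relation.Binary.PropositionalEquality using (_≡_)

-- Variables are pairs (c , p) with p : Var c, so the variable
-- sets of distinct components are automatically disjoint.
module Components {a b v : Level} (Cmp : Set a) (Beh : Cmp → Set b) (Var : Cmp → Set v) where

  CSet : Set (suc a)
  CSet = Cmp → Set a

  _⊆_ : CSet → CSet → Set a
  C ⊆ D = ∀ c → C c → D c

  Nonempty : CSet → Set a
  Nonempty C = Σ Cmp C

  BehC : CSet → Set (a ⊔ b)
  BehC C = (c : Cmp) → C c → Beh c

  record System (ℓ : Level) : Set (suc a ⊔ b ⊔ suc ℓ) where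
    field
      Comp     : CSet
      nonempty : Nonempty Comp
      Bh       : Set ℓ
      run      : Bh → BehC Comp
  open System public

  proj : ∀ {ℓ} (f : System ℓ) {D : CSet} → D ⊆ Comp f → Bh f → BehC D
  proj f D⊆ x c d = run f x c (D⊆ c d)

  IsImplementation : ∀ {ℓ ℓ'} (f : System ℓ) (g : System ℓ') →
                     (Comp g ⊆ Comp f) → (Bh f → Bh g) → Set (a ⊔ b ⊔ ℓ)
  IsImplementation f g incl σ =
    ∀ x c (d : Comp g c) → proj f incl x c d ≡ run g (σ x) c d

  Valuation : (ℓ : Level) → Set (a ⊔ b ⊔ v ⊔ suc ℓ)
  Valuation ℓ = (c : Cmp) → Var c → Beh c → Set ℓ

  data Formula (C : CSet) : Set (a ⊔ v) where
    var  : (c : Cmp) → C c → Var c → Formula C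
    _∧_  : Formula C → Formula C → Formula C
    ¬_   : Formula C → Formula C

  Sat : ∀ {ℓ ℓv} {C : CSet} (f : System ℓ) → C ⊆ Comp f →
        Valuation ℓv → Bh f → Formula C → Set ℓv
  Sat f C⊆ V x (var c d p) = V c p (run f x c (C⊆ c d))
  Sat f C⊆ V x (α ∧ β)     = Sat f C⊆ V x α × Sat f C⊆ V x β
  Sat f C⊆ V x (¬ α)       = Sat f C⊆ V x α → ⊥

  ⊆-refl : {C : CSet} → C ⊆ C
  ⊆-refl c d = d

module Submission where

open import Defs
open import Level using (Level)
open import Function.Bundles using (_⇔_; mk⇔)
open import Data.Product.Function.NonDependent.Propositional using (_×-⇔_)
open import Function.Related.TypeIsomorphisms using (¬-cong-⇔)
open import Relation.Binary.PropositionalEquality using (_≡_; subst; sym)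

-- Satisfaction of a formula over C only inspects the behaviours of the
-- components in C, so any two points agreeing on them satisfy the same
-- formulas; an implementation σ makes x and σ x agree on Comp(g).

subst-⇔ : ∀ {a p} {A : Set a} (P : A → Set p) {x y : A} → x ≡ y → P x ⇔ P y
subst-⇔ P x≡y = mk⇔ (subst P x≡y) (subst P (sym x≡y))

module _ {a b v : Level} {Cmp : Set a} {Beh : Cmp → Set b} {Var : Cmp → Set v} where
  open Components Cmp Beh Var

  module _ {ℓ ℓ' ℓv} {C : CSet} (f : System ℓ) (g : System ℓ')
           (C⊆f : C ⊆ Comp f) (C⊆g : C ⊆ Comp g) (V : Valuation ℓv)
           {x : Bh f} {y : Bh g}
           (agree : ∀ c (d : C c) → run f x c (C⊆f c d) ≡ run g y c (C⊆g c d)) where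

    Sat-cong : ∀ α → Sat f C⊆f V x α ⇔ Sat g C⊆g V y α
    Sat-cong (var c d p) = subst-⇔ (V c p) (agree c d)
    Sat-cong (α ∧ β)     = Sat-cong α ×-⇔ Sat-cong β
    Sat-cong (¬ α)       = ¬-cong-⇔ (Sat-cong α)

lemma3 : ∀ {a b v ℓ ℓ' ℓv : Level} (Cmp : Set a) (Beh : Cmp → Set b) (Var : Cmp → Set v) →
         let open Components Cmp Beh Var in
         (f : System ℓ) (g : System ℓ') (incl : Comp g ⊆ Comp f)
         (σ : Bh f → Bh g) → IsImplementation f g incl σ →
         (V : Valuation ℓv) (α : Formula (Comp g)) →
         ∀ (x : Bh f) → Sat f incl V x α ⇔ Sat g ⊆-refl V (σ x) α
lemma3 Cmp Beh Var f g incl σ implements V α x =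
  Sat-cong f g incl (Components.⊆-refl Cmp Beh Var) V (implements x) α
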